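{- Let $G$ be a non-complete graph with a universal vertex $v$ (i.e. $v$ is adjacent to all other vertices). Suppose that $G-v$ has $q$ components, of which $p$ are trivial (single vertices). (a) If $q\ge 3$, then $rc(G)=rc^\ell(G)=\max(p,3)$. (b) If $q\in\{1,2\}$, then $2\le rc(G)\le rc^\ell(G)\le 3$.
   Context: All graphs are finite, simple and undirected. An edge-coloured path is rainbow if all its edges have distinct colours. An (not necessarily proper) edge-colouring of a connected graph $G$ is rainbow connected if any two vertices are joined by a rainbow path; $rc(G)$ is the minimum number of colours in a rainbow connected edge-colouring of $G$. An $r$-edge-list assignment of $G$ assigns to each edge $e$ a set $L(e)\subset\mathbb N$ with $|L(e)|\ge r$; an $L$-edge-colouring is an edge-colouring $c$ with $c(e)\in L(e)$ for all $e$. $rc^\ell(G)$ is the minimum integer $r$ such that for every $r$-edge-list assignment $L$ of $G$ there exists a rainbow connected $L$-edge-colouring of $G$. -}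

module Defs where

open import Data.Nat using (ℕ; zero; suc; _<_; _≤_; _⊔_)
open import Data.Fin using (Fin; _≟_)
open import Data.Bool using (Bool; true; false; T; not; _∧_; _∨_; if_then_else_)
open import Data.List using (List; []; _∷_; map; allFin)
open import Data.Nat.ListAction using (sum)
open import Data.Bool.ListAction using (all)
open import Data.List.Relation.Unary.All using (All)
open import Data.List.Relation.Unary.Unique.Propositional using (Unique)
open import Data.Product using (Σ; _×_; _,_; ∃)
open import Relation.Binary.PropositionalEquality using (_≡_; _≢_)
open import Relation.Nullary using (¬_)
open import Relation.Nullary.Decidable using (⌊_⌋)
open import Function.Definitions using (Injective)
open import Function.Bundles using (_⇔_)

record Graph (n : ℕ) : Set where
  field
    adj    : Fin n → Fin n → Bool
    sym    : ∀ u w → adj u w ≡ adj w u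
    irrefl : ∀ u → adj u u ≡ false

open Graph public

E : ∀ {n} → Graph n → Fin n → Fin n → Set
E G u w = T (adj G u w)

-- A path is given by its start vertex u and the list xs of remaining vertices.
endpoint : ∀ {n} → Fin n → List (Fin n) → Fin n
endpoint u []       = u
endpoint u (x ∷ xs) = endpoint x xs

steps : ∀ {n} → Fin n → List (Fin n) → List (Fin n × Fin n)
steps u []       = []
steps u (x ∷ xs) = (u , x) ∷ steps x xs

IsPath : ∀ {n} → Graph n → Fin n → List (Fin n) → Set
IsPath G u xs = All (λ { (a , b) → E G a b }) (steps u xs) × Unique (u ∷ xs)

edgeColours : ∀ {n} → (Fin n → Fin n → ℕ) → Fin n → List (Fin n) → List ℕ
edgeColours c u xs = map (λ { (a , b) → c a b }) (steps u xs)

RainbowPath : ∀ {n} → Graph n → (Fin n → Fin n → ℕ) → Fin n → Fin n → Set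
RainbowPath G c u w =
  Σ (List (Fin n)) λ xs → IsPath G u xs × endpoint u xs ≡ w × Unique (edgeColours c u xs)
  where n = _

RainbowConnected : ∀ {n} → Graph n → (Fin n → Fin n → ℕ) → Set
RainbowConnected G c = ∀ u w → RainbowPath G c u w

SymColouring : ∀ {n} → (Fin n → Fin n → ℕ) → Set
SymColouring c = ∀ u w → c u w ≡ c w u

RCWith : ∀ {n} → Graph n → ℕ → Set
RCWith {n} G k = Σ (Fin n → Fin n → ℕ) λ c →
  SymColouring c × (∀ u w → E G u w → c u w < k) × RainbowConnected G c

IsRc : ∀ {n} → Graph n → ℕ → Set
IsRc G r = RCWith G r × (∀ k → k < r → ¬ RCWith G k)

AtLeast : ℕ → (ℕ → Set) → Set
AtLeast r P = Σ (Fin r → ℕ) λ f → Injective _≡_ _≡_ f × (∀ i → P (f i))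

-- every r-edge-list assignment admits a rainbow connected L-edge-colouring
-- (a list assignment is a symmetric family of sets L u w ⊆ ℕ on vertex pairs;
--  only the values on edges matter)
ListRC : ∀ {n} → Graph n → ℕ → Set₁
ListRC {n} G r =
  (L : Fin n → Fin n → ℕ → Set) →
  (∀ u w x → L u w x → L w u x) →
  (∀ u w → E G u w → AtLeast r (L u w)) →
  Σ (Fin n → Fin n → ℕ) λ c →
    SymColouring c × (∀ u w → E G u w → L u w (c u w)) × RainbowConnected G c

IsRcList : ∀ {n} → Graph n → ℕ → Set₁
IsRcList G r = ListRC G r × (∀ k → k < r → ¬ ListRC G k)

NonComplete : ∀ {n} → Graph n → Set
NonComplete G = Σ _ λ u → Σ _ λ w → u ≢ w × adj G u w ≡ false

Universal : ∀ {n} → Graph n → Fin n → Set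
Universal G v = ∀ u → u ≢ v → E G v u

ConnectedAvoiding : ∀ {n} → Graph n → Fin n → Fin n → Fin n → Set
ConnectedAvoiding G v x y =
  Σ _ λ xs → IsPath G x xs × endpoint x xs ≡ y × All (λ z → z ≢ v) (x ∷ xs)

-- G - v has exactly q components: a surjective labelling of the vertices of
-- G - v by Fin q whose fibres are exactly the connected components
HasComponents : ∀ {n} → Graph n → Fin n → ℕ → Set
HasComponents {n} G v q = Σ (Fin n → Fin q) λ comp →
  (∀ i → Σ (Fin n) λ x → x ≢ v × comp x ≡ i) ×
  (∀ x y → x ≢ v → y ≢ v → (comp x ≡ comp y ⇔ ConnectedAvoiding G v x y))

isolatedB : ∀ {n} → Graph n → Fin n → Fin n → Bool
isolatedB {n} G v x =
  not ⌊ x ≟ v ⌋ ∧ all (λ y → ⌊ y ≟ v ⌋ ∨ not (adj G x y)) (allFin n)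

trivialCount : ∀ {n} → Graph n → Fin n → ℕ
trivialCount {n} G v = sum (map (λ x → if isolatedB G v x then 1 else 0) (allFin n))

{-# OPTIONS --safe #-}
-- Lower bounds: a rainbow path between two isolated vertices of G − v can only be x v y, so the
-- spokes (edges at v) of isolated vertices get pairwise distinct colours and rc ≥ p; with two
-- colours rainbow paths have at most two edges, so vertices in different components of G − v are
-- joined only through v, and three components force rc ≥ 3; rc ≥ 2 as G is not complete.
-- Upper bound from lists of size r ≥ max(p, 3): give the spokes of isolated vertices distinct
-- colours, the spoke of every other vertex x a colour different from the spoke of its least
-- neighbour in G − v, and each edge of G − v (the rim) a colour avoiding the spokes at its ends.
-- Non-adjacent u, w are then joined by the rainbow path u v w or, when their spokes agree, by
-- u x v w or u v x w through such a neighbour x.  As p ≤ q, this gives rc^ℓ ≤ 3 when q ≤ 2;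
-- whether 2 colours (or 2-lists) suffice is decided by exhaustive search.
module Submission where

open import Defs hiding (sym)
open import Data.Bool using (T; true; false; not; _∨_; if_then_else_)
open import Data.Empty using (⊥-elim)
open import Data.Fin using (Fin; toℕ; fromℕ<; zero; suc; _≟_; inject≤)
import Data.Fin as Fin
open import Data.Fin.Properties
  using (any?; injective⇒≤; inject≤-injective; toℕ-fromℕ<; toℕ<n; toℕ-injective)
import Data.Fin.Properties as Fin
open import Data.List using (List; []; _∷_; length; lookup; map; filter; allFin; cartesianProduct)
open import Data.List.Properties using (length-map)
open import Data.List.Membership.Propositional using (_∈_; _∉_)
open import Data.List.Membership.Propositional.Properties
  using (∈-lookup; ∈-map⁺; ∈-allFin; ∈-filter⁺; ∈-filter⁻; ∈-cartesianProduct⁺)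
open import Data.List.Relation.Unary.All using (All; []; _∷_)
import Data.List.Relation.Unary.All as All
open import Data.List.Relation.Unary.All.Properties using (all⁺; all⁻)
open import Data.List.Relation.Unary.AllPairs using ([]; _∷_)
open import Data.List.Relation.Unary.Any using (here; there; index)
open import Data.List.Relation.Unary.Any.Properties using (lookup-index)
open import Data.List.Relation.Unary.Unique.Propositional using (Unique)
import Data.List.Relation.Unary.Unique.Propositional.Properties as Unique
import Data.List.Relation.Unary.Unique.DecPropositional as UniqueDec
open import Data.Nat using (ℕ; zero; suc; _+_; _⊔_; _<_; _≤_; z≤n; s≤s) renaming (_≟_ to _≟ℕ_)
open import Data.Nat.ListAction using (sum)
open import Data.Nat.Properties
  using (n≤1+n; <⇒≤; <⇒≱; ≮⇒≥; ≤-refl; ≤-reflexive; ≤-trans; <-≤-trans; ≤-pred; ⊔-lub; m≤m⊔n; m≤n⊔m;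
         +-comm; +-suc; +-monoʳ-≤; +-monoʳ-<; +-mono-≤; m≤m+n; module ≤-Reasoning)
open import Data.List.Membership.DecPropositional _≟ℕ_ using (_∈?_)
open import Data.Product using (Σ; ∃; _×_; _,_; proj₁; proj₂; uncurry; swap)
open import Data.Sum using (_⊎_; inj₁; inj₂)
open import Data.Vec using (Vec; []; _∷_)
import Data.Vec as Vec
open import Data.Vec.Properties using (lookup∘tabulate)
open import Function using (_∘_; id)
open import Function.Bundles using (Equivalence; _⇔_)
open import Function.Definitions using (Injective)
open import Relation.Binary.Definitions using (DecidableEquality; tri<; tri≈; tri>)
open import Relation.Binary.PropositionalEquality
  using (_≡_; _≢_; refl; sym; trans; cong; cong₂; subst; module ≡-Reasoning)
open import Relation.Nullary using (¬_; Dec; yes; no; ¬?; _×-dec_; _→-dec_; does; contradiction)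
open import Relation.Nullary.Decidable using (⌊_⌋; T?; map′; decidable-stable)
open import Relation.Unary using (Decidable)

module _ {A : Set} where

  lookup-injective : {xs : List A} → Unique xs → ∀ i j → lookup xs i ≡ lookup xs j → i ≡ j
  lookup-injective (_ ∷ _) zero zero _ = refl
  lookup-injective (x∉ ∷ _) zero (suc j) eq = contradiction eq (All.lookup x∉ (∈-lookup j))
  lookup-injective (x∉ ∷ _) (suc i) zero eq = contradiction (sym eq) (All.lookup x∉ (∈-lookup i))
  lookup-injective (_ ∷ u) (suc i) (suc j) eq = cong suc (lookup-injective u i j eq)

  length≤-of-injection : {xs : List A} {k : ℕ} → Unique xs → (f : A → ℕ) →
    (∀ {x} → x ∈ xs → f x < k) → (∀ {x y} → x ∈ xs → y ∈ xs → f x ≡ f y → x ≡ y) →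
    length xs ≤ k
  length≤-of-injection {xs} u f f<k f-inj = injective⇒≤ {f = g} g-injective
    where
    g : Fin (length xs) → Fin _
    g i = fromℕ< (f<k (∈-lookup i))
    g-injective : ∀ {i j} → g i ≡ g j → i ≡ j
    g-injective {i} {j} eq = lookup-injective u i j (f-inj (∈-lookup i) (∈-lookup j)
      (trans (sym (toℕ-fromℕ< _)) (trans (cong toℕ eq) (toℕ-fromℕ< _))))

sum-indicator : {A : Set} {P : A → Set} (P? : Decidable P) (xs : List A) →
  sum (map (λ x → if does (P? x) then 1 else 0) xs) ≡ length (filter P? xs)
sum-indicator P? [] = refl
sum-indicator P? (x ∷ xs) with does (P? x)
... | true = cong suc (sum-indicator P? xs)
... | false = sum-indicator P? xs

fresh : ∀ {r} (P : ℕ → Set) → AtLeast r P → (ys : List ℕ) → length ys < r → ∃ λ x → P x × x ∉ ys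
fresh {r} P (f , f-inj , Pf) ys ys<r with any? (λ i → ¬? (f i ∈? ys))
... | yes (i , fi∉ys) = f i , Pf i , fi∉ys
... | no all∈ys = contradiction (injective⇒≤ position-injective) (<⇒≱ ys<r)
  where
  member : ∀ i → f i ∈ ys
  member i with f i ∈? ys
  ... | yes fi∈ys = fi∈ys
  ... | no fi∉ys = contradiction (i , fi∉ys) all∈ys
  position-injective : ∀ {i j} → index (member i) ≡ index (member j) → i ≡ j
  position-injective {i} {j} eq = f-inj (trans (lookup-index (member i))
    (trans (cong (lookup ys) eq) (sym (lookup-index (member j)))))

atLeast-mono : ∀ {k r} {P : ℕ → Set} → k ≤ r → AtLeast r P → AtLeast k P
atLeast-mono k≤r (f , f-inj , Pf) =
  (λ i → f (inject≤ i k≤r)) , (λ eq → inject≤-injective k≤r k≤r _ _ (f-inj eq)) , λ i → Pf _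

module _ {A : Set} (_≟_ : DecidableEquality A) {r : ℕ}
  (P : A → ℕ → Set) (W : ∀ t → AtLeast r (P t)) where

  distinct-choice : (ts : List A) → length ts ≤ r →
    Σ (A → ℕ) λ g → (∀ {t} → t ∈ ts → P t (g t)) × (∀ {t t'} → t ∈ ts → t' ∈ ts → g t ≡ g t' → t ≡ t')
  distinct-choice [] _ = (λ _ → 0) , (λ ()) , λ ()
  distinct-choice (t ∷ ts) ts<r with distinct-choice ts (<⇒≤ ts<r)
  ... | g₀ , g₀∈P , g₀-injective = g , g∈P , g-injective
    where
    new : ∃ λ x → P t x × x ∉ map g₀ ts
    new = fresh (P t) (W t) (map g₀ ts) (subst (_< r) (sym (length-map g₀ ts)) ts<r)
    g : A → ℕ
    g y = if does (y ≟ t) then proj₁ new else g₀ y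
    g∈P : ∀ {y} → y ∈ t ∷ ts → P y (g y)
    g∈P {y} y∈ with y ≟ t
    ... | yes refl = proj₁ (proj₂ new)
    g∈P (here y≡t) | no y≢t = contradiction y≡t y≢t
    g∈P (there y∈ts) | no _ = g₀∈P y∈ts
    old≢new : ∀ {y} → y ∈ ts → g₀ y ≢ proj₁ new
    old≢new y∈ts eq = proj₂ (proj₂ new) (subst (_∈ map g₀ ts) eq (∈-map⁺ g₀ y∈ts))
    g-injective : ∀ {y y'} → y ∈ t ∷ ts → y' ∈ t ∷ ts → g y ≡ g y' → y ≡ y'
    g-injective {y} {y'} y∈ y'∈ eq with y ≟ t | y' ≟ t
    ... | yes refl | yes refl = refl
    g-injective y∈ (here y'≡t) eq | _ | no y'≢t = contradiction y'≡t y'≢t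
    g-injective (here y≡t) y'∈ eq | no y≢t | _ = contradiction y≡t y≢t
    g-injective y∈ (there y'∈ts) eq | yes refl | no _ = contradiction (sym eq) (old≢new y'∈ts)
    g-injective (there y∈ts) y'∈ eq | no _ | yes refl = contradiction eq (old≢new y∈ts)
    g-injective (there y∈ts) (there y'∈ts) eq | no _ | no _ = g₀-injective y∈ts y'∈ts eq

least? : ∀ {k} {P : Fin k → Set} → Decidable P →
  (Σ (Fin k) λ y → P y × ∀ {z} → P z → y Fin.≤ z) ⊎ (∀ z → ¬ P z)
least? {zero} P? = inj₂ λ ()
least? {suc k} P? with P? zero | least? (P? ∘ suc)
... | yes p₀ | _ = inj₁ (zero , p₀ , λ _ → z≤n)
... | no ¬p₀ | inj₁ (y , py , y-least) =
  inj₁ (suc y , py , λ { {zero} p₀ → contradiction p₀ ¬p₀ ; {suc z} pz → s≤s (y-least pz) })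
... | no ¬p₀ | inj₂ none = inj₂ λ { zero → ¬p₀ ; (suc z) → none z }

double-< : ∀ {a b} p q → a < b → p ≤ 1 → a + a + p < b + b + q
double-< {a} {b} p q a<b p≤1 = begin-strict
  a + a + p         ≤⟨ +-monoʳ-≤ (a + a) p≤1 ⟩
  a + a + 1         ≡⟨ +-comm (a + a) 1 ⟩
  suc (a + a)       <⟨ s≤s (≤-reflexive (sym (+-suc a a))) ⟩
  suc a + suc a     ≤⟨ +-mono-≤ a<b a<b ⟩
  b + b             ≤⟨ m≤m+n (b + b) q ⟩
  b + b + q         ∎
  where open ≤-Reasoning

-- Since m (m x) ≤ x, the only cycles of m are 2-cycles; the smaller vertex of such a cycle is
-- its base.  Colour bases freely and every other vertex away from the colour of its image: this
-- recursion terminates because the potential 2 (x + m x) + [x is not a base] drops along m.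
module AwayFromImage {n : ℕ} (m : Fin n → Fin n) (D : Fin n → Set)
  (D-closed : ∀ {x} → D x → D (m x)) (m-moves : ∀ {x} → D x → m x ≢ x)
  (m²≤ : ∀ {x} → D x → m (m x) Fin.≤ x)
  (P : Fin n → ℕ → Set) (W : ∀ x → AtLeast 2 (P x)) where

  IsBase : Fin n → Set
  IsBase x = m (m x) ≡ x × x Fin.< m x

  base? : ∀ x → Dec (IsBase x)
  base? x = (m (m x) ≟ x) ×-dec (x Fin.<? m x)

  penalty : ∀ {x} → Dec (IsBase x) → ℕ
  penalty (yes _) = 0
  penalty (no _) = 1

  weight : Fin n → ℕ
  weight x = toℕ x + toℕ (m x)

  potential : Fin n → ℕ
  potential x = weight x + weight x + penalty (base? x)

  penalty≤1 : ∀ {x} (d : Dec (IsBase x)) → penalty d ≤ 1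
  penalty≤1 (yes _) = z≤n
  penalty≤1 (no _) = ≤-refl

  penalty-base : ∀ {x} (d : Dec (IsBase x)) → IsBase x → penalty d ≡ 0
  penalty-base (yes _) _ = refl
  penalty-base (no ¬base) base = contradiction base ¬base

  penalty-¬base : ∀ {x} (d : Dec (IsBase x)) → ¬ IsBase x → penalty d ≡ 1
  penalty-¬base (yes base) ¬base = contradiction base ¬base
  penalty-¬base (no _) _ = refl

  potential-decreases : ∀ {x} → D x → ¬ IsBase x → potential (m x) < potential x
  potential-decreases {x} Dx ¬base = by-cases (m (m x) ≟ x)
    where
    by-cases : Dec (m (m x) ≡ x) → potential (m x) < potential x
    by-cases (no m²x≢x) = double-< (penalty (base? (m x))) (penalty (base? x)) lighter (penalty≤1 _)
      where
      lighter : weight (m x) < weight x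
      lighter = subst (weight (m x) <_) (+-comm (toℕ (m x)) (toℕ x))
        (+-monoʳ-< (toℕ (m x)) (Fin.≤∧≢⇒< (m²≤ Dx) m²x≢x))
    by-cases (yes m²x≡x) = begin-strict
      weight (m x) + weight (m x) + penalty (base? (m x))
        ≡⟨ cong₂ (λ w p → w + w + p) same-weight (penalty-base (base? (m x)) mx-base) ⟩
      weight x + weight x + 0
        <⟨ +-monoʳ-< (weight x + weight x) (s≤s z≤n) ⟩
      weight x + weight x + 1
        ≡⟨ cong (weight x + weight x +_) (sym (penalty-¬base (base? x) ¬base)) ⟩
      potential x ∎
      where
      open ≤-Reasoning
      same-weight : weight (m x) ≡ weight x
      same-weight = trans (cong (λ y → toℕ (m x) + toℕ y) m²x≡x) (+-comm (toℕ (m x)) (toℕ x))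
      mx<x : m x Fin.< x
      mx<x with Fin.<-cmp (m x) x
      ... | tri< mx<x _ _ = mx<x
      ... | tri≈ _ mx≡x _ = contradiction mx≡x (m-moves Dx)
      ... | tri> _ _ x<mx = contradiction (m²x≡x , x<mx) ¬base
      mx-base : IsBase (m x)
      mx-base = cong m m²x≡x , subst (m x Fin.<_) (sym m²x≡x) mx<x

  awayFrom : ∀ x (ys : List ℕ) → length ys < 2 → ∃ λ c → P x c × c ∉ ys
  awayFrom x = fresh (P x) (W x)

  step : ∀ {x} → Dec (IsBase x) → ℕ → ℕ
  step {x} (yes _) _ = proj₁ (awayFrom x [] (s≤s z≤n))
  step {x} (no _) c = proj₁ (awayFrom x (c ∷ []) ≤-refl)

  step∈P : ∀ {x} (d : Dec (IsBase x)) c → P x (step d c)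
  step∈P {x} (yes _) _ = proj₁ (proj₂ (awayFrom x [] (s≤s z≤n)))
  step∈P {x} (no _) c = proj₁ (proj₂ (awayFrom x (c ∷ []) ≤-refl))

  step-avoids : ∀ {x} (d : Dec (IsBase x)) c → ¬ IsBase x → step d c ≢ c
  step-avoids (yes base) _ ¬base = contradiction base ¬base
  step-avoids {x} (no _) c _ eq = proj₂ (proj₂ (awayFrom x (c ∷ []) ≤-refl)) (here eq)

  colourWithin : ℕ → Fin n → ℕ
  colourWithin zero _ = 0 -- never reached from colour, whose fuel exceeds the potential
  colourWithin (suc k) x = step (base? x) (colourWithin k (m x))

  colour : Fin n → ℕ
  colour x = colourWithin (suc (potential x)) x

  colourWithin-stable : ∀ {x} j k → D x → potential x < j → potential x < k →
    colourWithin j x ≡ colourWithin k x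
  colourWithin-stable {x} (suc j) (suc k) Dx pot<j pot<k = by-cases (base? x)
    where
    by-cases : (d : Dec (IsBase x)) → step d (colourWithin j (m x)) ≡ step d (colourWithin k (m x))
    by-cases (yes _) = refl
    by-cases (no ¬base) = cong (step (no ¬base)) (colourWithin-stable j k (D-closed Dx)
      (<-≤-trans (potential-decreases Dx ¬base) (≤-pred pot<j))
      (<-≤-trans (potential-decreases Dx ¬base) (≤-pred pot<k)))

  colour∈P : ∀ x → P x (colour x)
  colour∈P x = step∈P (base? x) _

  colour-away : ∀ {x} → D x → ¬ IsBase x → colour x ≢ colour (m x)
  colour-away {x} Dx ¬base eq = step-avoids (base? x) _ ¬base (trans eq (sym
    (colourWithin-stable (potential x) (suc (potential (m x))) (D-closed Dx)
      (potential-decreases Dx ¬base) ≤-refl)))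

  colour-differs : ∀ {x} → D x → colour x ≢ colour (m x)
  colour-differs {x} Dx = by-cases (base? x)
    where
    by-cases : Dec (IsBase x) → colour x ≢ colour (m x)
    by-cases (no ¬base) = colour-away Dx ¬base
    by-cases (yes (m²x≡x , x<mx)) eq = colour-away (D-closed Dx) ¬base-mx
      (trans (sym eq) (cong colour (sym m²x≡x)))
      where
      ¬base-mx : ¬ IsBase (m x)
      ¬base-mx (_ , mx<m²x) = Fin.<-asym x<mx (subst (m x Fin.<_) m²x≡x mx<m²x)

module _ {n : ℕ} where

  orientBy : ∀ {u w : Fin n} → Dec (u Fin.≤ w) → Fin n × Fin n
  orientBy {u} {w} (yes _) = u , w
  orientBy {u} {w} (no _) = w , u

  orient : Fin n → Fin n → Fin n × Fin n
  orient u w = orientBy (u Fin.≤? w)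

  orient-sym : ∀ u w → orient u w ≡ orient w u
  orient-sym u w = by-cases (u Fin.≤? w) (w Fin.≤? u)
    where
    by-cases : (d : Dec (u Fin.≤ w)) (d' : Dec (w Fin.≤ u)) → orientBy d ≡ orientBy d'
    by-cases (yes u≤w) (yes w≤u) with Fin.≤-antisym u≤w w≤u
    ... | refl = refl
    by-cases (yes _) (no _) = refl
    by-cases (no _) (yes _) = refl
    by-cases (no u≰w) (no w≰u) with Fin.≤-total u w
    ... | inj₁ u≤w = contradiction u≤w u≰w
    ... | inj₂ w≤u = contradiction w≤u w≰u

  orient-cases : ∀ u w → orient u w ≡ (u , w) ⊎ orient u w ≡ (w , u)
  orient-cases u w with u Fin.≤? w
  ... | yes _ = inj₁ refl
  ... | no _ = inj₂ refl

  symmetrise : {B : Set} → (Fin n → Fin n → B) → Fin n → Fin n → B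
  symmetrise κ u w = uncurry κ (orient u w)

  symmetrise-sym : {B : Set} (κ : Fin n → Fin n → B) → ∀ u w → symmetrise κ u w ≡ symmetrise κ w u
  symmetrise-sym κ u w = cong (uncurry κ) (orient-sym u w)

  symmetrise-cases : {B : Set} (κ : Fin n → Fin n → B) → ∀ u w →
    symmetrise κ u w ≡ κ u w ⊎ symmetrise κ u w ≡ κ w u
  symmetrise-cases κ u w with orient-cases u w
  ... | inj₁ eq = inj₁ (cong (uncurry κ) eq)
  ... | inj₂ eq = inj₂ (cong (uncurry κ) eq)

-- Rainbow paths and lower bounds

module _ {n : ℕ} (G : Graph n) where

  E-sym : ∀ {u w} → E G u w → E G w u
  E-sym {u} {w} = subst T (Graph.sym G u w)

  E⇒≢ : ∀ {u w} → E G u w → u ≢ w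
  E⇒≢ {u} e refl = subst T (irrefl G u) e

  Walk : Fin n → List (Fin n) → Set
  Walk u xs = All (λ { (a , b) → E G a b }) (steps u xs)

  module _ {c : Fin n → Fin n → ℕ} where

    trivialPath : ∀ {u} → RainbowPath G c u u
    trivialPath = [] , ([] , [] ∷ []) , refl , []

    edgePath : ∀ {u w} → E G u w → RainbowPath G c u w
    edgePath e = _ ∷ [] , (e ∷ [] , (E⇒≢ e ∷ []) ∷ [] ∷ []) , refl , [] ∷ []

    rainbowPath₂ : ∀ {u x w} → E G u x → E G x w → u ≢ w → c u x ≢ c x w → RainbowPath G c u w
    rainbowPath₂ e₁ e₂ u≢w c₁≢c₂ =
      _ ∷ _ ∷ [] , (e₁ ∷ e₂ ∷ [] , (E⇒≢ e₁ ∷ u≢w ∷ []) ∷ (E⇒≢ e₂ ∷ []) ∷ [] ∷ []) , refl ,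
      (c₁≢c₂ ∷ []) ∷ [] ∷ []

    rainbowPath₃ : ∀ {u x y w} → E G u x → E G x y → E G y w → u ≢ y → u ≢ w → x ≢ w →
      c u x ≢ c x y → c u x ≢ c y w → c x y ≢ c y w → RainbowPath G c u w
    rainbowPath₃ e₁ e₂ e₃ u≢y u≢w x≢w c₁≢c₂ c₁≢c₃ c₂≢c₃ =
      _ ∷ _ ∷ _ ∷ [] ,
      (e₁ ∷ e₂ ∷ e₃ ∷ [] ,
       (E⇒≢ e₁ ∷ u≢y ∷ u≢w ∷ []) ∷ (E⇒≢ e₂ ∷ x≢w ∷ []) ∷ (E⇒≢ e₃ ∷ []) ∷ [] ∷ []) ,
      refl , (c₁≢c₂ ∷ c₁≢c₃ ∷ []) ∷ (c₂≢c₃ ∷ []) ∷ [] ∷ []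

    length-edgeColours : ∀ u xs → length (edgeColours c u xs) ≡ length xs
    length-edgeColours u [] = refl
    length-edgeColours u (x ∷ xs) = cong suc (length-edgeColours x xs)

    walk-colours< : ∀ {k} → (∀ u w → E G u w → c u w < k) →
      ∀ {u} xs → Walk u xs → All (_< k) (edgeColours c u xs)
    walk-colours< c<k [] [] = []
    walk-colours< c<k (x ∷ xs) (e ∷ es) = c<k _ x e ∷ walk-colours< c<k xs es

    rainbowPath-length≤ : ∀ {k u w} → (∀ u w → E G u w → c u w < k) →
      (p : RainbowPath G c u w) → length (proj₁ p) ≤ k
    rainbowPath-length≤ {u = u} c<k (xs , (walk , _) , _ , distinct) =
      subst (_≤ _) (length-edgeColours u xs)
        (length≤-of-injection distinct id (All.lookup (walk-colours< c<k xs walk)) λ _ _ eq → eq)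

  ¬rcWith-nonComplete : ∀ {k} → NonComplete G → k ≤ 1 → ¬ RCWith G k
  ¬rcWith-nonComplete (a , b , a≢b , ¬ab) k≤1 (c , _ , c<k , rc)
    with rc a b | rainbowPath-length≤ c<k (rc a b)
  ... | [] , _ , refl , _ | _ = a≢b refl
  ... | _ ∷ [] , (e ∷ [] , _) , refl , _ | _ = subst T ¬ab e
  ... | _ ∷ _ ∷ _ , _ | 2≤k with ≤-trans 2≤k k≤1
  ...   | s≤s ()

  lastEdge : ∀ a b zs → Walk a (b ∷ zs) → ∃ λ p → p ∈ a ∷ b ∷ zs × E G p (endpoint b zs)
  lastEdge a b [] (e ∷ []) = a , here refl , e
  lastEdge a b (z ∷ zs) (_ ∷ walk) with lastEdge b z zs walk
  ... | p , p∈ , e = p , there p∈ , e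

  module _ (v : Fin n) where

    Isolated : Fin n → Set
    Isolated x = x ≢ v × (∀ {y} → E G x y → y ≡ v)

    isolatedB-sound : ∀ {x} → T (isolatedB G v x) → Isolated x
    isolatedB-sound {x} t with x ≟ v
    ... | yes _ = ⊥-elim t
    ... | no x≢v = x≢v , λ {y} e → only-v y e (All.lookup (all⁺ _ (allFin n) t) (∈-allFin y))
      where
      only-v : ∀ y → E G x y → T (⌊ y ≟ v ⌋ ∨ not (adj G x y)) → y ≡ v
      only-v y e t with y ≟ v | adj G x y
      ... | yes y≡v | _ = y≡v
      ... | no _ | true = ⊥-elim t
      ... | no _ | false = ⊥-elim e

    isolatedB-complete : ∀ {x} → Isolated x → T (isolatedB G v x)
    isolatedB-complete {x} (x≢v , only-v) with x ≟ v
    ... | yes x≡v = x≢v x≡v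
    ... | no _ = all⁻ _ {allFin n} (All.tabulate λ {y} _ → avoids y)
      where
      avoids : ∀ y → T (⌊ y ≟ v ⌋ ∨ not (adj G x y))
      avoids y with y ≟ v | adj G x y in xy
      ... | yes _ | _ = _
      ... | no y≢v | true = y≢v (only-v (subst T (sym xy) _))
      ... | no _ | false = _

    isolated? : Decidable Isolated
    isolated? x = map′ isolatedB-sound isolatedB-complete (T? (isolatedB G v x))

    trivialVertices : List (Fin n)
    trivialVertices = filter isolated? (allFin n)

    trivialCount-length : trivialCount G v ≡ length trivialVertices
    trivialCount-length = sum-indicator isolated? (allFin n)

    ∈-trivialVertices : ∀ {x} → Isolated x → x ∈ trivialVertices
    ∈-trivialVertices {x} = ∈-filter⁺ isolated? (∈-allFin x)

    trivialCount≤ : ∀ {k} (f : Fin n → ℕ) → (∀ {x} → Isolated x → f x < k) →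
      (∀ {x y} → Isolated x → Isolated y → x ≢ y → f x ≢ f y) → trivialCount G v ≤ k
    trivialCount≤ f f<k f-distinct =
      subst (_≤ _) (sym trivialCount-length)
        (length≤-of-injection (Unique.filter⁺ isolated? (Unique.allFin⁺ n)) f
          (f<k ∘ isolated-of) f-injective)
      where
      isolated-of : ∀ {x} → x ∈ trivialVertices → Isolated x
      isolated-of = proj₂ ∘ ∈-filter⁻ isolated? {xs = allFin n}
      f-injective : ∀ {x y} → x ∈ trivialVertices → y ∈ trivialVertices → f x ≡ f y → x ≡ y
      f-injective {x} {y} x∈ y∈ eq with x ≟ y
      ... | yes x≡y = x≡y
      ... | no x≢y = contradiction eq
        (f-distinct (isolated-of x∈) (isolated-of y∈) x≢y)

    hub-colours-differ : ∀ {c x y} (p : RainbowPath G c x y) → proj₁ p ≡ v ∷ y ∷ [] → c x v ≢ c v y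
    hub-colours-differ (_ , _ , _ , (c≢ ∷ []) ∷ _) refl = c≢

    isolated-path : ∀ {x y} xs → Isolated x → Isolated y → x ≢ y →
      IsPath G x xs → endpoint x xs ≡ y → xs ≡ v ∷ y ∷ []
    isolated-path [] _ _ x≢y _ refl = contradiction refl x≢y
    isolated-path (z ∷ zs) (_ , x-only-v) y-iso x≢y (e ∷ walk , distinct) ep
      with x-only-v e
    isolated-path (_ ∷ []) _ (y≢v , _) _ _ ep | refl = contradiction (sym ep) y≢v
    isolated-path (_ ∷ _ ∷ []) _ _ _ _ refl | refl = refl
    isolated-path (_ ∷ a ∷ b ∷ zs) _ (_ , y-only-v) _ (_ ∷ _ ∷ walk , _ ∷ (v∉ ∷ _)) ep | refl
      with lastEdge a b zs walk
    ... | p , p∈ , e = contradiction (sym (y-only-v (E-sym (subst (E G p) ep e)))) (All.lookup v∉ p∈)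

    isolated-spokes-differ : ∀ {c x y} → SymColouring c → RainbowConnected G c →
      Isolated x → Isolated y → x ≢ y → c x v ≢ c y v
    isolated-spokes-differ {c} {x} {y} c-sym rc x-iso y-iso x≢y eq with rc x y
    ... | p@(_ , path , ep , _) =
      hub-colours-differ p (isolated-path _ x-iso y-iso x≢y path ep) (trans eq (c-sym y v))

    trivialCount≤colours : ∀ {k} → Universal G v → RCWith G k → trivialCount G v ≤ k
    trivialCount≤colours univ (c , c-sym , c<k , rc) =
      trivialCount≤ (λ x → c x v) (λ x-iso → c<k _ _ (E-sym (univ _ (proj₁ x-iso))))
        (isolated-spokes-differ c-sym rc)

    module _ {q : ℕ} (H : HasComponents G v q) where

      private
        comp : Fin n → Fin q
        comp = proj₁ H
        representative : ∀ i → Σ (Fin n) λ x → x ≢ v × comp x ≡ i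
        representative = proj₁ (proj₂ H)
        component-iff : ∀ x y → x ≢ v → y ≢ v → (comp x ≡ comp y ⇔ ConnectedAvoiding G v x y)
        component-iff = proj₂ (proj₂ H)

      same-component : ∀ {x y} → x ≢ v → y ≢ v → ConnectedAvoiding G v x y → comp x ≡ comp y
      same-component {x} {y} x≢v y≢v = Equivalence.from (component-iff x y x≢v y≢v)

      separated-path : ∀ {x y} xs → x ≢ v → y ≢ v → comp x ≢ comp y →
        IsPath G x xs → endpoint x xs ≡ y → length xs ≤ 2 → xs ≡ v ∷ y ∷ []
      separated-path [] _ _ separated _ refl _ = contradiction refl separated
      separated-path (_ ∷ []) x≢v y≢v separated path refl _ =
        contradiction (same-component x≢v y≢v (_ , path , refl , x≢v ∷ y≢v ∷ [])) separated
      separated-path (z ∷ _ ∷ []) x≢v y≢v separated path refl _ with z ≟ v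
      ... | yes refl = refl
      ... | no z≢v =
        contradiction (same-component x≢v y≢v (_ , path , refl , x≢v ∷ z≢v ∷ y≢v ∷ [])) separated
      separated-path (_ ∷ _ ∷ _ ∷ _) _ _ _ _ _ (s≤s (s≤s ()))

      isolated-separated : ∀ {x y} → Isolated x → Isolated y → x ≢ y → comp x ≢ comp y
      isolated-separated (x≢v , x-only-v) (y≢v , _) x≢y eq
        with Equivalence.to (component-iff _ _ x≢v y≢v) eq
      ... | [] , _ , refl , _ = x≢y refl
      ... | _ ∷ _ , (e ∷ _ , _) , _ , _ ∷ z≢v ∷ _ = z≢v (x-only-v e)

      trivialCount≤components : trivialCount G v ≤ q
      trivialCount≤components =
        trivialCount≤ (toℕ ∘ comp) (λ _ → toℕ<n _)
          λ x-iso y-iso x≢y → isolated-separated x-iso y-iso x≢y ∘ toℕ-injective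

      separated-spokes-differ : ∀ {c x y} → SymColouring c → (∀ u w → E G u w → c u w < 2) →
        RainbowConnected G c → x ≢ v → y ≢ v → comp x ≢ comp y → c x v ≢ c y v
      separated-spokes-differ {c} {x} {y} c-sym c<2 rc x≢v y≢v separated eq with rc x y
      ... | p@(_ , path , ep , _) = hub-colours-differ p
        (separated-path _ x≢v y≢v separated path ep (rainbowPath-length≤ c<2 p)) (trans eq (c-sym y v))

      components≤2 : Universal G v → RCWith G 2 → q ≤ 2
      components≤2 univ (c , c-sym , c<2 , rc) = injective⇒≤ {f = spokeColour} spokeColour-injective
        where
        rep : Fin q → Fin n
        rep i = proj₁ (representative i)
        rep≢v : ∀ i → rep i ≢ v
        rep≢v i = proj₁ (proj₂ (representative i))
        spokeColour : Fin q → Fin 2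
        spokeColour i = fromℕ< (c<2 _ _ (E-sym (univ _ (rep≢v i))))
        spokeColour-injective : ∀ {i j} → spokeColour i ≡ spokeColour j → i ≡ j
        spokeColour-injective {i} {j} eq with i ≟ j
        ... | yes i≡j = i≡j
        ... | no i≢j = contradiction (trans (sym (toℕ-fromℕ< _)) (trans (cong toℕ eq) (toℕ-fromℕ< _)))
          (separated-spokes-differ c-sym c<2 rc (rep≢v i) (rep≢v j) λ same → i≢j
            (trans (sym (proj₂ (proj₂ (representative i))))
              (trans same (proj₂ (proj₂ (representative j))))))

-- The list colouring for the upper bound

module _ {n : ℕ} (G : Graph n) where

  atLeast-onEdges : ∀ {r} (L : Fin n → Fin n → ℕ → Set) → (∀ u w → E G u w → AtLeast r (L u w)) →
    ∀ u w → AtLeast r (λ x → E G u w → L u w x)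
  atLeast-onEdges L W u w with T? (adj G u w)
  ... | yes e = proj₁ (W u w e) , proj₁ (proj₂ (W u w e)) , λ i _ → proj₂ (proj₂ (W u w e)) i
  ... | no ¬e = toℕ , toℕ-injective , λ _ e → contradiction e ¬e

module UpperBound {n : ℕ} {G : Graph n} {v : Fin n} (univ : Universal G v)
  {r : ℕ} (3≤r : 3 ≤ r) (p≤r : trivialCount G v ≤ r)
  (L : Fin n → Fin n → ℕ → Set) (L-sym : ∀ u w x → L u w x → L w u x)
  (W : ∀ u w → E G u w → AtLeast r (L u w)) where

  Neighbour : Fin n → Fin n → Set
  Neighbour x y = y ≢ v × E G x y

  neighbour? : ∀ x → Decidable (Neighbour x)
  neighbour? x y = ¬? (y ≟ v) ×-dec T? (adj G x y)

  NonIsolated : Fin n → Set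
  NonIsolated x = x ≢ v × ∃ (Neighbour x)

  isolated-or-nonIsolated : ∀ {x} → x ≢ v → Isolated G v x ⊎ NonIsolated x
  isolated-or-nonIsolated {x} x≢v with any? (neighbour? x)
  ... | yes nb = inj₂ (x≢v , nb)
  ... | no ¬nb = inj₁ (x≢v , only-v)
    where
    only-v : ∀ {y} → E G x y → y ≡ v
    only-v {y} e with y ≟ v
    ... | yes y≡v = y≡v
    ... | no y≢v = contradiction (y , y≢v , e) ¬nb

  nonIsolated⇒¬isolated : ∀ {x} → NonIsolated x → ¬ Isolated G v x
  nonIsolated⇒¬isolated (_ , y , y≢v , e) (_ , only-v) = y≢v (only-v e)

  leastNeighbourBy : ∀ {x} → (Σ (Fin n) λ y → Neighbour x y × ∀ {z} → Neighbour x z → y Fin.≤ z) ⊎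
    (∀ z → ¬ Neighbour x z) → Fin n
  leastNeighbourBy (inj₁ (y , _)) = y
  leastNeighbourBy {x} (inj₂ _) = x -- junk: x has no neighbour in G − v

  leastNeighbour : Fin n → Fin n
  leastNeighbour x = leastNeighbourBy (least? (neighbour? x))

  leastNeighbour-least : ∀ {x} → NonIsolated x →
    Neighbour x (leastNeighbour x) × ∀ {z} → Neighbour x z → leastNeighbour x Fin.≤ z
  leastNeighbour-least {x} (_ , y , nb) with least? (neighbour? x)
  ... | inj₁ (_ , nb-least , least) = nb-least , least
  ... | inj₂ none = contradiction nb (none y)

  private
    m : Fin n → Fin n
    m = leastNeighbour

  nonIsolated-closed : ∀ {x} → NonIsolated x → NonIsolated (m x)
  nonIsolated-closed {x} x-nonIso@(x≢v , _) with leastNeighbour-least x-nonIso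
  ... | (mx≢v , e) , _ = mx≢v , x , x≢v , E-sym G e

  m-moves : ∀ {x} → NonIsolated x → m x ≢ x
  m-moves x-nonIso = E⇒≢ G (E-sym G (proj₂ (proj₁ (leastNeighbour-least x-nonIso))))

  m²≤ : ∀ {x} → NonIsolated x → m (m x) Fin.≤ x
  m²≤ {x} x-nonIso@(x≢v , _) = proj₂ (leastNeighbour-least (nonIsolated-closed x-nonIso))
    (x≢v , E-sym G (proj₂ (proj₁ (leastNeighbour-least x-nonIso))))

  edgeLists : ∀ u w → AtLeast r (λ c → E G u w → L u w c)
  edgeLists = atLeast-onEdges G L W

  spokeLists : ∀ x → AtLeast r (λ c → E G v x → L v x c)
  spokeLists = edgeLists v

  spokeLists₂ : ∀ x → AtLeast 2 (λ c → E G v x → L v x c)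
  spokeLists₂ x = atLeast-mono {P = λ c → E G v x → L v x c} (≤-trans (n≤1+n 2) 3≤r) (spokeLists x)

  open AwayFromImage m NonIsolated nonIsolated-closed m-moves m²≤ (λ x c → E G v x → L v x c) spokeLists₂
    using ()
    renaming (colour to nonIsolatedSpoke; colour∈P to nonIsolatedSpoke∈L;
              colour-differs to nonIsolatedSpoke-differs)

  private
    isolatedChoice : Σ (Fin n → ℕ) λ g → (∀ {x} → x ∈ trivialVertices G v → E G v x → L v x (g x)) ×
      (∀ {x y} → x ∈ trivialVertices G v → y ∈ trivialVertices G v → g x ≡ g y → x ≡ y)
    isolatedChoice = distinct-choice _≟_ (λ x c → E G v x → L v x c) spokeLists (trivialVertices G v)
      (subst (_≤ r) (trivialCount-length G v) p≤r)

  isolatedSpoke : Fin n → ℕ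
  isolatedSpoke = proj₁ isolatedChoice

  spokeBy : ∀ {x} → Dec (Isolated G v x) → ℕ
  spokeBy {x} (yes _) = isolatedSpoke x
  spokeBy {x} (no _) = nonIsolatedSpoke x

  spoke : Fin n → ℕ
  spoke x = spokeBy (isolated? G v x)

  spoke-isolated : ∀ {x} → Isolated G v x → spoke x ≡ isolatedSpoke x
  spoke-isolated {x} x-iso = by-cases (isolated? G v x)
    where
    by-cases : (d : Dec (Isolated G v x)) → spokeBy d ≡ isolatedSpoke x
    by-cases (yes _) = refl
    by-cases (no ¬iso) = contradiction x-iso ¬iso

  spoke-nonIsolated : ∀ {x} → NonIsolated x → spoke x ≡ nonIsolatedSpoke x
  spoke-nonIsolated {x} x-nonIso = by-cases (isolated? G v x)
    where
    by-cases : (d : Dec (Isolated G v x)) → spokeBy d ≡ nonIsolatedSpoke x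
    by-cases (yes x-iso) = contradiction x-iso (nonIsolated⇒¬isolated x-nonIso)
    by-cases (no _) = refl

  spoke∈L : ∀ {x} → x ≢ v → L v x (spoke x)
  spoke∈L {x} x≢v with isolated-or-nonIsolated x≢v
  ... | inj₁ x-iso = subst (L v x) (sym (spoke-isolated x-iso))
    (proj₁ (proj₂ isolatedChoice) (∈-trivialVertices G v x-iso) (univ x x≢v))
  ... | inj₂ x-nonIso =
    subst (L v x) (sym (spoke-nonIsolated x-nonIso)) (nonIsolatedSpoke∈L x (univ x x≢v))

  spokes-distinct : ∀ {x y} → Isolated G v x → Isolated G v y → x ≢ y → spoke x ≢ spoke y
  spokes-distinct x-iso y-iso x≢y eq = x≢y (proj₂ (proj₂ isolatedChoice)
    (∈-trivialVertices G v x-iso) (∈-trivialVertices G v y-iso)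
    (trans (sym (spoke-isolated x-iso)) (trans eq (spoke-isolated y-iso))))

  spoke-dichotomy : ∀ {x} → x ≢ v → Isolated G v x ⊎ ∃ λ y → Neighbour x y × spoke x ≢ spoke y
  spoke-dichotomy x≢v with isolated-or-nonIsolated x≢v
  ... | inj₁ x-iso = inj₁ x-iso
  ... | inj₂ x-nonIso = inj₂ (m _ , proj₁ (leastNeighbour-least x-nonIso) , λ eq →
    nonIsolatedSpoke-differs x-nonIso (trans (sym (spoke-nonIsolated x-nonIso))
      (trans eq (spoke-nonIsolated (nonIsolated-closed x-nonIso)))))

  rimChoice : ∀ u w → ∃ λ c → (E G u w → L u w c) × c ∉ spoke u ∷ spoke w ∷ []
  rimChoice u w = fresh _ (edgeLists u w) (spoke u ∷ spoke w ∷ []) 3≤r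

  rimColour : Fin n → Fin n → ℕ
  rimColour u w = proj₁ (rimChoice u w)

  rimColour∈L : ∀ {u w} → E G u w → L u w (rimColour u w)
  rimColour∈L {u} {w} = proj₁ (proj₂ (rimChoice u w))

  rimColour-avoids : ∀ u w → rimColour u w ≢ spoke u × rimColour u w ≢ spoke w
  rimColour-avoids u w = (λ eq → ∉ (here eq)) , λ eq → ∉ (there (here eq))
    where
    ∉ : rimColour u w ∉ spoke u ∷ spoke w ∷ []
    ∉ = proj₂ (proj₂ (rimChoice u w))

  colourBy : ∀ u w → Dec (u ≡ v) → Dec (w ≡ v) → ℕ
  colourBy u w (yes _) _ = spoke w
  colourBy u w (no _) (yes _) = spoke u
  colourBy u w (no _) (no _) = rimColour u w

  preColour : Fin n → Fin n → ℕ
  preColour u w = colourBy u w (u ≟ v) (w ≟ v)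

  preColour-spoke : ∀ {x} → x ≢ v → preColour v x ≡ spoke x × preColour x v ≡ spoke x
  preColour-spoke {x} x≢v = hub (v ≟ v) (x ≟ v) , rim (x ≟ v) (v ≟ v)
    where
    hub : ∀ d d' → colourBy v x d d' ≡ spoke x
    hub (yes _) _ = refl
    hub (no v≢v) _ = contradiction refl v≢v
    rim : ∀ d d' → colourBy x v d d' ≡ spoke x
    rim (yes x≡v) _ = contradiction x≡v x≢v
    rim (no _) (yes _) = refl
    rim (no _) (no v≢v) = contradiction refl v≢v

  preColour-rim : ∀ {u w} → u ≢ v → w ≢ v → preColour u w ≡ rimColour u w
  preColour-rim {u} {w} u≢v w≢v = by-cases (u ≟ v) (w ≟ v)
    where
    by-cases : ∀ d d' → colourBy u w d d' ≡ rimColour u w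
    by-cases (yes u≡v) _ = contradiction u≡v u≢v
    by-cases (no _) (yes w≡v) = contradiction w≡v w≢v
    by-cases (no _) (no _) = refl

  preColour∈L : ∀ {u w} → E G u w → L u w (preColour u w)
  preColour∈L {u} {w} e with u ≟ v | w ≟ v
  ... | yes refl | _ = spoke∈L (E⇒≢ G e ∘ sym)
  ... | no u≢v | yes refl = L-sym v u _ (spoke∈L u≢v)
  ... | no _ | no _ = rimColour∈L e

  colouring : Fin n → Fin n → ℕ
  colouring = symmetrise preColour

  colouring-spokeˡ : ∀ {x} → x ≢ v → colouring v x ≡ spoke x
  colouring-spokeˡ {x} x≢v with symmetrise-cases preColour v x
  ... | inj₁ eq = trans eq (proj₁ (preColour-spoke x≢v))
  ... | inj₂ eq = trans eq (proj₂ (preColour-spoke x≢v))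

  colouring-spokeʳ : ∀ {x} → x ≢ v → colouring x v ≡ spoke x
  colouring-spokeʳ {x} x≢v = trans (symmetrise-sym preColour x v) (colouring-spokeˡ x≢v)

  colouring-rim-avoids : ∀ {u w} → u ≢ v → w ≢ v → colouring u w ≢ spoke u × colouring u w ≢ spoke w
  colouring-rim-avoids {u} {w} u≢v w≢v with symmetrise-cases preColour u w
  ... | inj₁ eq rewrite eq | preColour-rim u≢v w≢v = rimColour-avoids u w
  ... | inj₂ eq rewrite eq | preColour-rim w≢v u≢v = swap (rimColour-avoids w u)

  colouring∈L : ∀ u w → E G u w → L u w (colouring u w)
  colouring∈L u w e with symmetrise-cases preColour u w
  ... | inj₁ eq = subst (L u w) (sym eq) (preColour∈L e)
  ... | inj₂ eq = subst (L u w) (sym eq) (L-sym w u _ (preColour∈L (E-sym G e)))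

  spoke-edge : ∀ {x} → x ≢ v → E G x v
  spoke-edge x≢v = E-sym G (univ _ x≢v)

  farPath : ∀ {u w} → u ≢ v → w ≢ v → u ≢ w → ¬ E G u w → RainbowPath G colouring u w
  farPath {u} {w} u≢v w≢v u≢w ¬e with spoke u ≟ℕ spoke w
  ... | no su≢sw = rainbowPath₂ G (spoke-edge u≢v) (univ w w≢v) u≢w λ eq →
    su≢sw (trans (sym (colouring-spokeʳ u≢v)) (trans eq (colouring-spokeˡ w≢v)))
  ... | yes su≡sw with spoke-dichotomy u≢v | spoke-dichotomy w≢v
  ...   | inj₁ u-iso | inj₁ w-iso = contradiction su≡sw (spokes-distinct u-iso w-iso u≢w)
  ...   | inj₂ (y , (y≢v , uy) , su≢sy) | _ =
    rainbowPath₃ G uy (spoke-edge y≢v) (univ w w≢v) u≢v u≢w (λ { refl → ¬e uy })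
      (λ eq → proj₂ (colouring-rim-avoids u≢v y≢v) (trans eq (colouring-spokeʳ y≢v)))
      (λ eq → proj₁ (colouring-rim-avoids u≢v y≢v) (trans eq (trans (colouring-spokeˡ w≢v) (sym su≡sw))))
      (λ eq → su≢sy (trans su≡sw
        (trans (sym (colouring-spokeˡ w≢v)) (trans (sym eq) (colouring-spokeʳ y≢v)))))
  ...   | inj₁ _ | inj₂ (z , (z≢v , wz) , sw≢sz) =
    rainbowPath₃ G (spoke-edge u≢v) (univ z z≢v) (E-sym G wz)
      (λ { refl → ¬e (E-sym G wz) }) u≢w (w≢v ∘ sym)
      (λ eq → sw≢sz (trans (sym su≡sw)
        (trans (sym (colouring-spokeʳ u≢v)) (trans eq (colouring-spokeˡ z≢v)))))
      (λ eq → proj₂ (colouring-rim-avoids z≢v w≢v) (trans (sym eq) (trans (colouring-spokeʳ u≢v) su≡sw)))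
      (λ eq → proj₁ (colouring-rim-avoids z≢v w≢v) (trans (sym eq) (colouring-spokeˡ z≢v)))

  rainbow : RainbowConnected G colouring
  rainbow u w with u ≟ w | T? (adj G u w)
  ... | yes refl | _ = trivialPath G
  ... | no _ | yes e = edgePath G e
  ... | no u≢w | no ¬e = farPath u≢v w≢v u≢w ¬e
    where
    u≢v : u ≢ v
    u≢v refl = ¬e (univ w (u≢w ∘ sym))
    w≢v : w ≢ v
    w≢v refl = ¬e (spoke-edge u≢w)

listRC-upper : ∀ {n} (G : Graph n) {v r} → Universal G v → 3 ≤ r → trivialCount G v ≤ r → ListRC G r
listRC-upper G univ 3≤r p≤r L L-sym W = colouring , symmetrise-sym preColour , colouring∈L , rainbow
  where open UpperBound {G = G} univ 3≤r p≤r L L-sym W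

-- Deciding whether two colours suffice

Searchable : Set → Set₁
Searchable A = ∀ {P : A → Set} → Decidable P → Dec (∃ P)

searchable-Vec : ∀ {A} → Searchable A → ∀ k → Searchable (Vec A k)
searchable-Vec search zero P? = map′ ([] ,_) (λ { ([] , p) → p }) (P? [])
searchable-Vec search (suc k) P? =
  map′ (λ { (a , as , p) → a ∷ as , p }) (λ { (a ∷ as , p) → a , as , p })
    (search λ a → searchable-Vec search k (P? ∘ (a ∷_)))

searchable⇒∀? : ∀ {A} → Searchable A → ∀ {P : A → Set} → Decidable P → Dec (∀ a → P a)
searchable⇒∀? search P? = map′ (λ ¬counterexample a → decidable-stable (P? a) (¬counterexample ∘ (a ,_)))
  (λ all-P (a , ¬Pa) → ¬Pa (all-P a)) (¬? (search (¬? ∘ P?)))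

boundedList? : ∀ {A} → Searchable A → ∀ k {P : List A → Set} → Decidable P →
  Dec (∃ λ xs → length xs ≤ k × P xs)
boundedList? search k P? with P? []
... | yes P[] = yes ([] , z≤n , P[])
boundedList? search zero P? | no ¬P[] = no λ { ([] , _ , P[]) → ¬P[] P[] }
boundedList? search (suc k) P? | no ¬P[] =
  map′ (λ { (x , xs , len≤ , p) → x ∷ xs , s≤s len≤ , p })
    (λ { ([] , _ , P[]) → contradiction P[] ¬P[] ; (x ∷ xs , s≤s len≤ , p) → x , xs , len≤ , p })
    (search λ x → boundedList? search k (P? ∘ (x ∷_)))

Matrix : Set → ℕ → Set
Matrix A n = Vec (Vec A n) n

module _ {A : Set} {n : ℕ} where

  _[_,_] : Matrix A n → Fin n → Fin n → A
  M [ u , w ] = Vec.lookup (Vec.lookup M u) w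

  tabulate² : (Fin n → Fin n → A) → Matrix A n
  tabulate² f = Vec.tabulate λ u → Vec.tabulate (f u)

  lookup-tabulate² : ∀ (f : Fin n → Fin n → A) u w → tabulate² f [ u , w ] ≡ f u w
  lookup-tabulate² f u w =
    trans (cong (λ row → Vec.lookup row w) (lookup∘tabulate _ u)) (lookup∘tabulate (f u) w)

  searchable-Matrix : Searchable A → Searchable (Matrix A n)
  searchable-Matrix search = searchable-Vec (searchable-Vec search n) n

injective₂ : ∀ {B : Set} (f : Fin 2 → B) → f zero ≢ f (suc zero) → Injective _≡_ _≡_ f
injective₂ f f₀≢f₁ {zero} {zero} _ = refl
injective₂ f f₀≢f₁ {zero} {suc zero} eq = contradiction eq f₀≢f₁
injective₂ f f₀≢f₁ {suc zero} {zero} eq = contradiction (sym eq) f₀≢f₁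
injective₂ f f₀≢f₁ {suc zero} {suc zero} _ = refl

toFin2 : ℕ → Fin 2
toFin2 zero = zero
toFin2 (suc _) = suc zero

toℕ-toFin2 : ∀ {k} → k < 2 → toℕ (toFin2 k) ≡ k
toℕ-toFin2 {zero} _ = refl
toℕ-toFin2 {suc zero} _ = refl
toℕ-toFin2 {suc (suc _)} (s≤s (s≤s ()))

module _ {n : ℕ} (G : Graph n) where

  rainbowPath? : ∀ c u w → Dec (RainbowPath G c u w)
  rainbowPath? c u w = map′ (λ (xs , _ , p) → xs , p) (λ (xs , p) → xs , short xs p , p)
    (boundedList? any? n λ xs →
      (All.all? (λ (a , b) → T? (adj G a b)) (steps u xs) ×-dec UniqueDec.unique? _≟_ (u ∷ xs)) ×-dec
      endpoint u xs ≟ w ×-dec UniqueDec.unique? _≟ℕ_ (edgeColours c u xs))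
    where
    short : ∀ xs → IsPath G u xs × endpoint u xs ≡ w × Unique (edgeColours c u xs) → length xs ≤ n
    short xs ((_ , distinct) , _) =
      <⇒≤ (length≤-of-injection distinct toℕ (λ _ → toℕ<n _) (λ _ _ → toℕ-injective))

  rainbowConnected? : ∀ c → Dec (RainbowConnected G c)
  rainbowConnected? c = Fin.all? λ u → Fin.all? λ w → rainbowPath? c u w

  module _ {c c' : Fin n → Fin n → ℕ}
    (refines : ∀ {a b a' b'} → E G a b → E G a' b' → c' a b ≡ c' a' b' → c a b ≡ c a' b') where

    distinct-refine : ∀ {a b} → E G a b → ∀ {u} xs → Walk G u xs →
      All (c a b ≢_) (edgeColours c u xs) → All (c' a b ≢_) (edgeColours c' u xs)
    distinct-refine ab [] [] [] = []
    distinct-refine ab (x ∷ xs) (e ∷ walk) (≢ ∷ ≢s) =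
      ≢ ∘ refines ab e ∷ distinct-refine ab xs walk ≢s

    unique-refine : ∀ {u} xs → Walk G u xs → Unique (edgeColours c u xs) → Unique (edgeColours c' u xs)
    unique-refine [] [] [] = []
    unique-refine (x ∷ xs) (e ∷ walk) (≢s ∷ distinct) =
      distinct-refine e xs walk ≢s ∷ unique-refine xs walk distinct

    rainbowConnected-refine : RainbowConnected G c → RainbowConnected G c'
    rainbowConnected-refine rc u w with rc u w
    ... | xs , path@(walk , _) , ep , distinct = xs , path , ep , unique-refine xs walk distinct

  rainbowConnected-onEdges : ∀ {c c'} → (∀ u w → E G u w → c u w ≡ c' u w) →
    RainbowConnected G c → RainbowConnected G c'
  rainbowConnected-onEdges agree = rainbowConnected-refine
    λ {a} {b} {a'} {b'} ab a'b' eq → trans (agree a b ab) (trans eq (sym (agree a' b' a'b')))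

  symmetrise-onEdges : ∀ {κ c} → SymColouring c → (∀ u w → E G u w → κ u w ≡ c u w) →
    ∀ u w → E G u w → symmetrise κ u w ≡ c u w
  symmetrise-onEdges {κ} c-sym agree u w e with symmetrise-cases κ u w
  ... | inj₁ eq = trans eq (agree u w e)
  ... | inj₂ eq = trans eq (trans (agree w u (E-sym G e)) (c-sym w u))

  Lists₂ : Set
  Lists₂ = Fin n → Fin n → Fin 2 → ℕ

  selection : Lists₂ → Matrix (Fin 2) n → Fin n → Fin n → ℕ
  selection κ σ = symmetrise λ u w → κ u w (σ [ u , w ])

  Selectable : Lists₂ → Set
  Selectable κ = ∃ λ σ → RainbowConnected G (selection κ σ)

  selectable? : ∀ κ → Dec (Selectable κ)
  selectable? κ = searchable-Matrix any? (rainbowConnected? ∘ selection κ)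

  rcWith2⇒selectable : RCWith G 2 → Selectable (λ _ _ → toℕ)
  rcWith2⇒selectable (c , c-sym , c<2 , rc) =
    σ , rainbowConnected-onEdges (λ u w e → sym (symmetrise-onEdges c-sym agree u w e)) rc
    where
    σ : Matrix (Fin 2) n
    σ = tabulate² λ u w → toFin2 (c u w)
    agree : ∀ u w → E G u w → toℕ (σ [ u , w ]) ≡ c u w
    agree u w e = trans (cong toℕ (lookup-tabulate² _ u w)) (toℕ-toFin2 (c<2 u w e))

  selectable⇒rcWith2 : Selectable (λ _ _ → toℕ) → RCWith G 2
  selectable⇒rcWith2 (σ , rc) =
    selection (λ _ _ → toℕ) σ , symmetrise-sym (λ u w → toℕ (σ [ u , w ])) , (λ u w _ → bound u w) , rc
    where
    bound : ∀ u w → selection (λ _ _ → toℕ) σ u w < 2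
    bound u w with symmetrise-cases (λ u w → toℕ (σ [ u , w ])) u w
    ... | inj₁ eq = subst (_< 2) (sym eq) (toℕ<n _)
    ... | inj₂ eq = subst (_< 2) (sym eq) (toℕ<n _)

  rcWith2? : Dec (RCWith G 2)
  rcWith2? = map′ selectable⇒rcWith2 rcWith2⇒selectable (selectable? (λ _ _ → toℕ))

  ValidLists : Lists₂ → Set
  ValidLists κ = ∀ u w → E G u w → κ u w zero ≢ κ u w (suc zero) × (∀ i → κ u w i ≡ κ w u i)

  validLists? : ∀ κ → Dec (ValidLists κ)
  validLists? κ = Fin.all? λ u → Fin.all? λ w → T? (adj G u w) →-dec
    (¬? (κ u w zero ≟ℕ κ u w (suc zero)) ×-dec Fin.all? λ i → κ u w i ≟ℕ κ w u i)

  listRC2⇒selectable : ListRC G 2 → ∀ κ → ValidLists κ → Selectable κ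
  listRC2⇒selectable listRC κ valid with listRC L L-sym W
    where
    L : Fin n → Fin n → ℕ → Set
    L u w x = E G u w → ∃ λ i → κ u w i ≡ x
    L-sym : ∀ u w x → L u w x → L w u x
    L-sym u w x x∈L wu with x∈L (E-sym G wu)
    ... | i , eq = i , trans (sym (proj₂ (valid u w (E-sym G wu)) i)) eq
    W : ∀ u w → E G u w → AtLeast 2 (L u w)
    W u w e = κ u w , injective₂ (κ u w) (proj₁ (valid u w e)) , λ i _ → i , refl
  ... | c , c-sym , c∈L , rc =
    σ , rainbowConnected-onEdges (λ u w e → sym (symmetrise-onEdges c-sym agree u w e)) rc
    where
    chosen : ∀ u w → Dec (E G u w) → Fin 2
    chosen u w (yes e) = proj₁ (c∈L u w e e)
    chosen u w (no _) = zero
    σ : Matrix (Fin 2) n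
    σ = tabulate² λ u w → chosen u w (T? (adj G u w))
    chosen-agrees : ∀ u w → E G u w → (d : Dec (E G u w)) → κ u w (chosen u w d) ≡ c u w
    chosen-agrees u w _ (yes e) = proj₂ (c∈L u w e e)
    chosen-agrees u w e (no ¬e) = contradiction e ¬e
    agree : ∀ u w → E G u w → κ u w (σ [ u , w ]) ≡ c u w
    agree u w e = trans (cong (κ u w) (lookup-tabulate² _ u w)) (chosen-agrees u w e (T? (adj G u w)))

  -- A 2-list assignment matters only through which listed colours coincide, so renaming each
  -- listed colour to the position of its first occurrence among all of them (one per slot)
  -- reduces ListRC G 2 to the finitely many assignments with colours below length slots.
  slots : List (Fin n × Fin n × Fin 2)
  slots = cartesianProduct (allFin n) (cartesianProduct (allFin n) (allFin 2))

  ∈-slots : ∀ u w i → (u , w , i) ∈ slots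
  ∈-slots u w i = ∈-cartesianProduct⁺ (∈-allFin u) (∈-cartesianProduct⁺ (∈-allFin w) (∈-allFin i))

  finiteLists : Matrix (Vec (Fin (length slots)) 2) n → Lists₂
  finiteLists A u w i = toℕ (Vec.lookup (A [ u , w ]) i)

  FiniteListRC : Set
  FiniteListRC = ∀ A → ValidLists (finiteLists A) → Selectable (finiteLists A)

  finiteListRC? : Dec FiniteListRC
  finiteListRC? = searchable⇒∀? (searchable-Matrix (searchable-Vec any? 2))
    λ A → validLists? (finiteLists A) →-dec selectable? (finiteLists A)

  module _ (L : Fin n → Fin n → ℕ → Set) (L-sym : ∀ u w x → L u w x → L w u x)
    (W : ∀ u w → E G u w → AtLeast 2 (L u w)) where

    lists : Lists₂
    lists = symmetrise λ u w → proj₁ (atLeast-onEdges G L W u w)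

    lists∈L : ∀ u w i → E G u w → L u w (lists u w i)
    lists∈L u w i e with symmetrise-cases (λ u w → proj₁ (atLeast-onEdges G L W u w)) u w
    ... | inj₁ eq = subst (λ f → L u w (f i)) (sym eq) (proj₂ (proj₂ (atLeast-onEdges G L W u w)) i e)
    ... | inj₂ eq = subst (λ f → L u w (f i)) (sym eq)
      (L-sym w u _ (proj₂ (proj₂ (atLeast-onEdges G L W w u)) i (E-sym G e)))

    lists-injective : ∀ u w → Injective _≡_ _≡_ (lists u w)
    lists-injective u w with symmetrise-cases (λ u w → proj₁ (atLeast-onEdges G L W u w)) u w
    ... | inj₁ eq rewrite eq = proj₁ (proj₂ (atLeast-onEdges G L W u w))
    ... | inj₂ eq rewrite eq = proj₁ (proj₂ (atLeast-onEdges G L W w u))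

    values : List ℕ
    values = map (λ (u , w , i) → lists u w i) slots

    ∈-values : ∀ u w i → lists u w i ∈ values
    ∈-values u w i = ∈-map⁺ _ (∈-slots u w i)

    position : ℕ → ℕ
    position x with x ∈? values
    ... | yes x∈ = toℕ (index x∈)
    ... | no _ = 0

    position< : ∀ {x} → x ∈ values → position x < length slots
    position< {x} x∈ with x ∈? values
    ... | yes x∈' = subst (toℕ (index x∈') <_) (length-map _ slots) (toℕ<n _)
    ... | no x∉ = contradiction x∈ x∉

    position-injective : ∀ {x y} → x ∈ values → y ∈ values → position x ≡ position y → x ≡ y
    position-injective {x} {y} x∈ y∈ eq with x ∈? values | y ∈? values
    ... | no x∉ | _ = contradiction x∈ x∉
    ... | _ | no y∉ = contradiction y∈ y∉
    ... | yes x∈' | yes y∈' = trans (lookup-index x∈')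
      (trans (cong (lookup values) (toℕ-injective eq)) (sym (lookup-index y∈')))

    renamed : Matrix (Vec (Fin (length slots)) 2) n
    renamed = tabulate² λ u w → Vec.tabulate λ i → fromℕ< (position< (∈-values u w i))

    renamed-position : ∀ u w i → finiteLists renamed u w i ≡ position (lists u w i)
    renamed-position u w i = begin
      toℕ (Vec.lookup (renamed [ u , w ]) i)
        ≡⟨ cong (λ row → toℕ (Vec.lookup row i)) (lookup-tabulate² _ u w) ⟩
      toℕ (Vec.lookup (Vec.tabulate λ i → fromℕ< (position< (∈-values u w i))) i)
        ≡⟨ cong toℕ (lookup∘tabulate (λ i → fromℕ< (position< (∈-values u w i))) i) ⟩
      toℕ (fromℕ< (position< (∈-values u w i)))
        ≡⟨ toℕ-fromℕ< _ ⟩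
      position (lists u w i) ∎
      where open ≡-Reasoning

    renamed-valid : ValidLists (finiteLists renamed)
    renamed-valid u w _ = distinct , symmetric
      where
      distinct : finiteLists renamed u w zero ≢ finiteLists renamed u w (suc zero)
      distinct eq with lists-injective u w
        (position-injective (∈-values u w zero) (∈-values u w (suc zero)) (trans (sym (renamed-position u w zero)) (trans eq (renamed-position u w (suc zero)))))
      ... | ()
      symmetric : ∀ i → finiteLists renamed u w i ≡ finiteLists renamed w u i
      symmetric i = trans (renamed-position u w i) (trans
        (cong (λ f → position (f i)) (symmetrise-sym (λ u w → proj₁ (atLeast-onEdges G L W u w)) u w))
        (sym (renamed-position w u i)))

    finiteListRC⇒colouring : FiniteListRC → Σ (Fin n → Fin n → ℕ) λ c →
      SymColouring c × (∀ u w → E G u w → L u w (c u w)) × RainbowConnected G c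
    finiteListRC⇒colouring finite with finite renamed renamed-valid
    ... | σ , rc = c , symmetrise-sym (λ u w → lists u w (σ [ u , w ])) , c∈L ,
      rainbowConnected-refine (λ {a} {b} {a'} {b'} _ _ eq →
        trans (selection-position a b) (trans (cong position eq) (sym (selection-position a' b')))) rc
      where
      c : Fin n → Fin n → ℕ
      c = selection lists σ
      selection-position : ∀ u w → selection (finiteLists renamed) σ u w ≡ position (c u w)
      selection-position u w = renamed-position (proj₁ (orient u w)) (proj₂ (orient u w)) _
      c∈L : ∀ u w → E G u w → L u w (c u w)
      c∈L u w e with symmetrise-cases (λ u w → lists u w (σ [ u , w ])) u w
      ... | inj₁ eq = subst (L u w) (sym eq) (lists∈L u w _ e)
      ... | inj₂ eq = subst (L u w) (sym eq) (L-sym w u _ (lists∈L w u _ (E-sym G e)))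

  listRC2? : Dec (ListRC G 2)
  listRC2? = map′ (λ finite L L-sym W → finiteListRC⇒colouring L L-sym W finite)
    (λ listRC A → listRC2⇒selectable listRC (finiteLists A)) finiteListRC?

module _ {n : ℕ} (G : Graph n) where

  listRC⇒rcWith : ∀ {k} → ListRC G k → RCWith G k
  listRC⇒rcWith {k} listRC =
    listRC (λ _ _ x → x < k) (λ _ _ _ → id) (λ _ _ _ → toℕ , toℕ-injective , toℕ<n)

  isRc-of : ∀ {r} → ListRC G r → (∀ k → k < r → ¬ RCWith G k) → IsRc G r
  isRc-of listRC below = listRC⇒rcWith listRC , below

  isRcList-of : ∀ {r} → ListRC G r → (∀ k → k < r → ¬ RCWith G k) → IsRcList G r
  isRcList-of listRC below = listRC , λ k k<r → below k k<r ∘ listRC⇒rcWith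

  ¬rcWith<2 : NonComplete G → ∀ k → k < 2 → ¬ RCWith G k
  ¬rcWith<2 nc k k<2 = ¬rcWith-nonComplete G nc (≤-pred k<2)

  ¬rcWith<3 : NonComplete G → ¬ RCWith G 2 → ∀ k → k < 3 → ¬ RCWith G k
  ¬rcWith<3 _ ¬rc2 2 _ = ¬rc2
  ¬rcWith<3 nc _ 0 _ = ¬rcWith<2 nc 0 (s≤s z≤n)
  ¬rcWith<3 nc _ 1 _ = ¬rcWith<2 nc 1 (s≤s (s≤s z≤n))
  ¬rcWith<3 _ _ (suc (suc (suc _))) (s≤s (s≤s (s≤s ())))

  rc-between-2-and-3 : NonComplete G → ListRC G 3 →
    Σ ℕ λ r → Σ ℕ λ s → IsRc G r × IsRcList G s × 2 ≤ r × r ≤ s × s ≤ 3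
  rc-between-2-and-3 nc listRC3 = by-cases (rcWith2? G) (listRC2? G)
    where
    by-cases : Dec (RCWith G 2) → Dec (ListRC G 2) →
      Σ ℕ λ r → Σ ℕ λ s → IsRc G r × IsRcList G s × 2 ≤ r × r ≤ s × s ≤ 3
    by-cases (no ¬rc2) _ = 3 , 3 , isRc-of listRC3 (¬rcWith<3 nc ¬rc2) ,
      isRcList-of listRC3 (¬rcWith<3 nc ¬rc2) , s≤s (s≤s z≤n) , ≤-refl , ≤-refl
    by-cases (yes rc2) (yes listRC2) = 2 , 2 , (rc2 , ¬rcWith<2 nc) , isRcList-of listRC2 (¬rcWith<2 nc) ,
      ≤-refl , ≤-refl , n≤1+n 2
    by-cases (yes rc2) (no ¬listRC2) = 2 , 3 , (rc2 , ¬rcWith<2 nc) , (listRC3 , ¬listRC<3) ,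
      ≤-refl , n≤1+n 2 , ≤-refl
      where
      ¬listRC<3 : ∀ k → k < 3 → ¬ ListRC G k
      ¬listRC<3 2 _ = ¬listRC2
      ¬listRC<3 0 _ = ¬rcWith<2 nc 0 (s≤s z≤n) ∘ listRC⇒rcWith
      ¬listRC<3 1 _ = ¬rcWith<2 nc 1 (s≤s (s≤s z≤n)) ∘ listRC⇒rcWith
      ¬listRC<3 (suc (suc (suc _))) (s≤s (s≤s (s≤s ())))

theorem2p3 : ∀ {n} (G : Graph n) (v : Fin n) (q p : ℕ) →
    NonComplete G → Universal G v → HasComponents G v q → p ≡ trivialCount G v →
    ((3 ≤ q → IsRc G (p ⊔ 3) × IsRcList G (p ⊔ 3)) ×
     ((q ≡ 1 ⊎ q ≡ 2) →
       Σ ℕ λ r → Σ ℕ λ s → IsRc G r × IsRcList G s × 2 ≤ r × r ≤ s × s ≤ 3))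
theorem2p3 G v q p nc univ components refl = part-a , part-b
  where
  part-a : 3 ≤ q → IsRc G (p ⊔ 3) × IsRcList G (p ⊔ 3)
  part-a 3≤q = isRc-of G upper below , isRcList-of G upper below
    where
    upper : ListRC G (p ⊔ 3)
    upper = listRC-upper G univ (m≤n⊔m p 3) (m≤m⊔n p 3)
    ¬rc2 : ¬ RCWith G 2
    ¬rc2 = <⇒≱ 3≤q ∘ components≤2 G v components univ
    below : ∀ k → k < p ⊔ 3 → ¬ RCWith G k
    below k k<p⊔3 rc = <⇒≱ k<p⊔3 (⊔-lub (trivialCount≤colours G v univ rc)
      (≮⇒≥ λ k<3 → ¬rcWith<3 G nc ¬rc2 k k<3 rc))
  part-b : (q ≡ 1 ⊎ q ≡ 2) → Σ ℕ λ r → Σ ℕ λ s → IsRc G r × IsRcList G s × 2 ≤ r × r ≤ s × s ≤ 3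
  part-b q∈12 = rc-between-2-and-3 G nc
    (listRC-upper G univ ≤-refl (≤-trans (trivialCount≤components G v components) (q≤3 q∈12)))
    where
    q≤3 : q ≡ 1 ⊎ q ≡ 2 → q ≤ 3
    q≤3 (inj₁ refl) = s≤s z≤n
    q≤3 (inj₂ refl) = s≤s (s≤s z≤n)
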